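{- Let $G$ be a connected block graph and let $D$ be its canonical decomposition. Then $G$ has a simplicial vertex of degree at least $2$ if and only if $D$ has a complete bag with more than $2$ vertices that contains an unmarked vertex.
   Context: Graphs are finite and simple. A graph is a block graph if every block (maximal connected subgraph without cut-vertices) is complete. A vertex is simplicial if its neighbors form a clique. For $X\subseteq V(G)$, $\mathrm{cutrk}_G(X)$ is the binary rank of the submatrix of the adjacency matrix with rows $X$ and columns $V(G)\setminus X$. A split of $G$ is a partition $(A,B)$ of $V(G)$ with $|A|,|B|\ge2$ and $\mathrm{cutrk}_G(A)\le1$. A graph without splits is prime. A marked graph has a designated set $M(D)$ of marked edges; a marked vertex is one incident with a marked edge. For a split $(A,B)$ of $G$, the simple decomposition is obtained from the disjoint union of $G[A]$ and $G[B]$ by the following steps: <ol> <li>add new vertices $a,b$ with a marked edge $ab$;</li> <li>join $a$ to all vertices of $A$ with a neighbor in $B$;</li> <li>join $b$ to all vertices of $B$ with a neighbor in $A$.</li> </ol> A split decomposition of a connected graph $G$ is either $G$ with no marked edges, or is obtained from a split decomposition $D$ by replacing a component $H$ of $D\setminus M(D)$ by a simple decomposition of $H$. The components of $D\setminus M(D)$ are bags. A bag is a star bag if it is isomorphic to $K_{1,n}$ for some $n\ge2$, with its non-leaf vertex called the center. A bag is a complete bag if it is isomorphic to $K_n$ for some $n\ge1$. Two bags are neighbors if joined by a marked edge. The canonical decomposition is the (unique) split decomposition satisfying all of the following: <ol> <li>each bag is prime, star or complete;</li> <li>no two complete bags are neighbors;</li> <li>a marked edge joining two star bags has both ends centers or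 both ends leaves.</li> </ol> -}

module Defs where

open import Data.Nat using (ℕ)
open import Data.Fin using (Fin)
open import Data.Bool using (Bool; true; false; _∧_)
open import Data.Sum using (_⊎_; inj₁; inj₂)
open import Data.Product using (Σ; ∃; ∃-syntax; _×_; _,_)
open import Data.Empty using (⊥)
open import Data.Unit using (⊤)
open import Relation.Nullary using (¬_)
open import Relation.Binary.PropositionalEquality using (_≡_; _≢_)
open import Relation.Binary.Construct.Closure.ReflexiveTransitive using (Star)
open import Function.Bundles using (_⇔_)

record Graph (n : ℕ) : Set where
  field
    adj   : Fin n → Fin n → Bool
    sym   : ∀ x y → adj x y ≡ adj y x
    irref : ∀ x → adj x x ≡ false

module _ {n : ℕ} (G : Graph n) where
  open Graph G

  E : Fin n → Fin n → Set
  E x y = adj x y ≡ true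

  Sub : Set
  Sub = Fin n → Bool

  _∈S_ : Fin n → Sub → Set
  x ∈S S = S x ≡ true

  ES : Sub → Fin n → Fin n → Set
  ES S x y = (x ∈S S) × (y ∈S S) × E x y

  ConnectedSub : Sub → Set
  ConnectedSub S = (∃[ x ] x ∈S S) × (∀ x y → x ∈S S → y ∈S S → Star (ES S) x y)

  remove : Sub → Fin n → Sub
  remove S v x = S x ∧ Dec≠ x
    where
    open import Data.Fin using (_≟_)
    open import Relation.Nullary using (yes; no)
    Dec≠ : Fin n → Bool
    Dec≠ x with x ≟ v
    ... | yes _ = false
    ... | no _  = true

  IsCutVertex : Sub → Fin n → Set
  IsCutVertex S v = (v ∈S S) ×
    (∃[ x ] ∃[ y ] (x ∈S remove S v) × (y ∈S remove S v) × ¬ Star (ES (remove S v)) x y)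

  NoCutVertex : Sub → Set
  NoCutVertex S = ∀ v → ¬ IsCutVertex S v

  _⊆S_ : Sub → Sub → Set
  S ⊆S T = ∀ x → x ∈S S → x ∈S T

  -- a block: a maximal connected subgraph without cut-vertices
  -- (maximal subgraphs of this kind are induced, so we work with vertex sets)
  IsBlock : Sub → Set
  IsBlock S = ConnectedSub S × NoCutVertex S ×
    (∀ T → S ⊆S T → ConnectedSub T → NoCutVertex T → T ⊆S S)

  IsComplete : Sub → Set
  IsComplete S = ∀ x y → x ∈S S → y ∈S S → x ≢ y → E x y

  Connected : Set
  Connected = ConnectedSub (λ _ → true)

  BlockGraph : Set
  BlockGraph = ∀ S → IsBlock S → IsComplete S

  Simplicial : Fin n → Set
  Simplicial v = ∀ x y → E v x → E v y → x ≢ y → E x y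

  HasSimplicialOfDegree≥2 : Set
  HasSimplicialOfDegree≥2 =
    ∃[ v ] Simplicial v × (∃[ x ] ∃[ y ] x ≢ y × E v x × E v y)

-- Marked graphs: U = unmarked edges, M = marked edges

record MarkedGraph : Set₁ where
  field
    V : Set
    U : V → V → Set
    M : V → V → Set

module _ (D : MarkedGraph) where
  open MarkedGraph D

  -- vertex v lies in the bag (component of D \ M(D)) containing r
  InBag : V → V → Set
  InBag r v = Star U r v

  InA : V → (V → Bool) → V → Set
  InA r side v = InBag r v × side v ≡ true

  InB : V → (V → Bool) → V → Set
  InB r side v = InBag r v × side v ≡ false

  -- binary cut-rank of A in the bag is at most 1 (the A×B adjacency
  -- matrix over GF(2) is an outer product f gᵀ)
  CutRank≤1 : V → (V → Bool) → Set
  CutRank≤1 r side = Σ (V → Bool) λ f → Σ (V → Bool) λ g →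
    ∀ x y → InA r side x → InB r side y → (U x y ⇔ (f x ∧ g y ≡ true))

  IsSplitOfBag : V → (V → Bool) → Set
  IsSplitOfBag r side =
    (∃[ x ] ∃[ y ] x ≢ y × InA r side x × InA r side y) ×
    (∃[ x ] ∃[ y ] x ≢ y × InB r side x × InB r side y) ×
    CutRank≤1 r side

  -- replacing the bag of r by its simple decomposition along (A , B);
  -- the new vertices are a = inj₂ true and b = inj₂ false
  simpleStep : V → (V → Bool) → MarkedGraph
  simpleStep r side = record { V = V ⊎ Bool ; U = U' ; M = M' }
    where
    A = InA r side
    B = InB r side
    U' : V ⊎ Bool → V ⊎ Bool → Set
    U' (inj₁ u) (inj₁ v) = U u v × ¬ (A u × B v) × ¬ (B u × A v)
    U' (inj₁ u) (inj₂ true) = A u × (∃[ w ] B w × U u w)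
    U' (inj₂ true) (inj₁ u) = A u × (∃[ w ] B w × U u w)
    U' (inj₁ u) (inj₂ false) = B u × (∃[ w ] A w × U u w)
    U' (inj₂ false) (inj₁ u) = B u × (∃[ w ] A w × U u w)
    U' (inj₂ _) (inj₂ _) = ⊥
    M' : V ⊎ Bool → V ⊎ Bool → Set
    M' (inj₁ u) (inj₁ v) = M u v
    M' (inj₂ true) (inj₂ false) = ⊤
    M' (inj₂ false) (inj₂ true) = ⊤
    M' _ _ = ⊥

  CompleteBag : V → Set
  CompleteBag r = ∀ x y → InBag r x → InBag r y → x ≢ y → U x y

  StarBagWithCenter : V → V → Set
  StarBagWithCenter r c = InBag r c ×
    (∀ x → InBag r x → x ≢ c → U c x) ×
    (∀ x y → InBag r x → InBag r y → x ≢ c → y ≢ c → ¬ U x y) ×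
    (∃[ x ] ∃[ y ] x ≢ y × x ≢ c × y ≢ c × InBag r x × InBag r y)

  StarBag : V → Set
  StarBag r = ∃[ c ] StarBagWithCenter r c

  PrimeBag : V → Set
  PrimeBag r = ¬ (∃[ side ] IsSplitOfBag r side)

  Canonical : Set
  Canonical =
    (∀ r → PrimeBag r ⊎ StarBag r ⊎ CompleteBag r) ×
    (∀ x y → M x y → ¬ (CompleteBag x × CompleteBag y)) ×
    (∀ x y → M x y → ∀ cx cy → StarBagWithCenter x cx → StarBagWithCenter y cy →
       (x ≡ cx ⇔ y ≡ cy))

  MarkedVertex : V → Set
  MarkedVertex v = ∃[ w ] M v w

  HasBigCompleteBagWithUnmarked : Set
  HasBigCompleteBagWithUnmarked = ∃[ r ] CompleteBag r ×
    (∃[ x ] ∃[ y ] ∃[ z ] x ≢ y × y ≢ z × x ≢ z × InBag r x × InBag r y × InBag r z) ×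
    (∃[ v ] InBag r v × ¬ MarkedVertex v)

baseMarked : ∀ {n} → Graph n → MarkedGraph
baseMarked {n} G = record { V = Fin n ; U = E G ; M = λ _ _ → ⊥ }

data SplitDecomposition {n : ℕ} (G : Graph n) : MarkedGraph → Set₁ where
  base : SplitDecomposition G (baseMarked G)
  step : ∀ {D} → SplitDecomposition G D → (r : MarkedGraph.V D) (side : MarkedGraph.V D → Bool) →
         IsSplitOfBag D r side → SplitDecomposition G (simpleStep D r side)

{-# OPTIONS --safe #-}
-- In a split decomposition D of G, every vertex p of D has a set of vertices of G accessible from
-- it by alternating paths (just x when p is the copy of x ∈ V(G)).  If p ≠ q lie in a common bag,
-- x is accessible from p and y from q, then x ≠ y, and xy ∈ E(G) iff pq ∈ E(D).  This holds for
-- G itself and survives simple decompositions; thus every bag is an induced subgraph of G up to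
-- isomorphism.  In a block graph the vertex set of a cycle is 2-connected, so it lies in a block
-- and is a clique.
--
-- (⇐) Let v be unmarked in a complete bag with at least three vertices.  The other bag vertices
-- give two neighbours of v.  Neighbours y, z of v are accessible from neighbours of v in the bag;
-- if these are distinct they are adjacent, hence so are y and z; if they coincide, y, z, v and a
-- vertex accessible from a third bag vertex form a 4-cycle with diagonal yz.
--
-- (⇒) Let v be simplicial with two neighbours; the closed neighbourhood N of v in its bag is a
-- clique.  If the bag is not complete, an edge q₁w leaves N.  If q₁ is the only neighbour of v in
-- the bag, the two neighbours of v in G close a 4-cycle through a vertex accessible from w, whose
-- diagonal would put w into N.  Otherwise the bag is not complete (w ∉ N), not a star (no vertex
-- of a star has two adjacent neighbours) and not prime: by the cycle property, q₁ separates the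
-- component of w in the bag minus N from the rest of the bag, which yields a split.  The bag has
-- three vertices because every bag created by a simple decomposition has, and the bag consisting
-- of vertices of G contains v and two of its neighbours.
--
-- Predicates on the vertices of D are only ¬¬-decidable; this suffices because every conclusion
-- drawn from them (adjacency in G or in a bag) is decidable.
module Submission where

open import Defs
open import Data.Nat using (ℕ)
open import Function.Bundles using (_⇔_)

open import Data.Bool using (Bool; true; false; not; _∧_)
import Data.Bool.Properties as Bool
open import Data.Empty using (⊥; ⊥-elim)
open import Data.Fin using (Fin; zero; suc) renaming (_≟_ to _≟ᶠ_)
open import Data.Fin.Subset using (∣_∣)
import Data.Fin.Subset as Subset
open import Data.Fin.Subset.Properties using (p⊂q⇒∣p∣<∣q∣; ∣p∣≤n)
open import Data.List using (List; []; _∷_; _++_; [_])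
open import Data.List.Properties using (++-assoc)
import Data.List.Membership.DecPropositional as DecMembership
open import Data.List.Membership.Propositional using (_∈_; _∉_)
open import Data.List.Membership.Propositional.Properties using (∈-∃++; ∈-++⁻; ∈-++⁺ˡ; ∈-++⁺ʳ)
open import Data.List.Relation.Binary.Subset.Propositional using (_⊆_)
open import Data.List.Relation.Unary.All as All using (All; []; _∷_)
open import Data.List.Relation.Unary.All.Properties using (¬Any⇒All¬; All¬⇒¬Any)
open import Data.List.Relation.Unary.AllPairs using ([]; _∷_)
open import Data.List.Relation.Unary.Any using (here; there)
open import Data.List.Relation.Unary.Linked using (Linked; []; [-]; _∷_)
open import Data.List.Relation.Unary.Unique.Propositional using (Unique)
open import Data.List.Relation.Unary.Unique.Propositional.Properties using (Unique[x∷xs]⇒x∉xs)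
open import Data.Nat using (_<_; _∸_)
open import Data.Nat.Induction using (<-wellFounded)
open import Data.Nat.Properties using (∸-monoʳ-<)
open import Data.Product using (∃; ∃-syntax; _×_; _,_; proj₁; proj₂)
open import Data.Sum using (_⊎_; inj₁; inj₂)
open import Data.Sum.Properties using (inj₁-injective) renaming (≡-dec to ⊎-≡-dec)
open import Data.Unit using (tt)
open import Data.Vec using (tabulate)
open import Data.Vec.Properties using (lookup∘tabulate; lookup⇒[]=; []=⇒lookup)
open import Function.Base using (id; _∘_; _on_)
open import Function.Bundles using (Equivalence; mk⇔)
open import Induction.WellFounded using (Acc; acc)
open import Relation.Binary.Construct.Closure.ReflexiveTransitive
  using (Star; ε; _◅_; _◅◅_; reverse; gmap; return)
import Relation.Binary.Construct.Closure.ReflexiveTransitive as Star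
import Relation.Binary.Construct.On as On
open import Relation.Binary.Definitions using (DecidableEquality)
open import Relation.Binary.PropositionalEquality
  using (_≡_; _≢_; refl; sym; trans; cong; cong₂; subst; ≢-sym)
open import Relation.Nullary using (¬_; Dec; yes; no; does; contradiction)
open import Relation.Nullary.Decidable
  using (dec-true; dec-false; decidable-stable; ¬¬-excluded-middle; map′; _×-dec_; _→-dec_; _⊎-dec_)
open import Relation.Unary using (Decidable)

does-true⁻ : {P : Set} (P? : Dec P) → does P? ≡ true → P
does-true⁻ (yes p) _ = p

does-false⁻ : {P : Set} (P? : Dec P) → does P? ≡ false → ¬ P
does-false⁻ (no ¬p) _ = ¬p

¬¬-decidable-Bool : (P : Bool → Set) → ¬ ¬ Decidable P
¬¬-decidable-Bool P k =
  ¬¬-excluded-middle λ P-true? → ¬¬-excluded-middle λ P-false? →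
    k λ { true → P-true? ; false → P-false? }

¬¬-decidable-Fin : ∀ {n} (P : Fin n → Set) → ¬ ¬ Decidable P
¬¬-decidable-Fin {ℕ.zero} P k = k λ ()
¬¬-decidable-Fin {ℕ.suc n} P k =
  ¬¬-excluded-middle λ P-zero? → ¬¬-decidable-Fin (P ∘ suc) λ P-suc? →
    k λ { zero → P-zero? ; (suc i) → P-suc? i }

¬¬-decidable-⊎ : {A B : Set} → ((P : A → Set) → ¬ ¬ Decidable P) →
                 ((P : B → Set) → ¬ ¬ Decidable P) →
                 (P : A ⊎ B → Set) → ¬ ¬ Decidable P
¬¬-decidable-⊎ ¬¬-decidable-A ¬¬-decidable-B P k =
  ¬¬-decidable-A (P ∘ inj₁) λ P₁? → ¬¬-decidable-B (P ∘ inj₂) λ P₂? →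
    k λ { (inj₁ a) → P₁? a ; (inj₂ b) → P₂? b }

ThreeDistinct : {A : Set} → (A → Set) → Set
ThreeDistinct P = ∃[ x ] ∃[ y ] ∃[ z ] x ≢ y × y ≢ z × x ≢ z × P x × P y × P z

ThreeDistinct-map : {A B : Set} {P : A → Set} {Q : B → Set} {f : A → B} →
                    (∀ {x y} → f x ≡ f y → x ≡ y) → (∀ {x} → P x → Q (f x)) →
                    ThreeDistinct P → ThreeDistinct Q
ThreeDistinct-map f-injective P⇒Q (x , y , z , x≢y , y≢z , x≢z , Px , Py , Pz) =
  _ , _ , _ , x≢y ∘ f-injective , y≢z ∘ f-injective , x≢z ∘ f-injective , P⇒Q Px , P⇒Q Py , P⇒Q Pz

module _ {A : Set} (_≟_ : DecidableEquality A) {P : A → Set} where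

  avoiding-two : ThreeDistinct P → ∀ p q → ∃[ c ] c ≢ p × c ≢ q × P c
  avoiding-two (x , y , z , x≢y , y≢z , x≢z , Px , Py , Pz) p q
    with x ≟ p | x ≟ q | y ≟ p | y ≟ q
  ... | no x≢p | no x≢q | _ | _ = x , x≢p , x≢q , Px
  ... | _ | _ | no y≢p | no y≢q = y , y≢p , y≢q , Py
  ... | yes refl | _ | yes refl | _ = ⊥-elim (x≢y refl)
  ... | _ | yes refl | _ | yes refl = ⊥-elim (x≢y refl)
  ... | yes refl | _ | _ | yes refl = z , ≢-sym x≢z , ≢-sym y≢z , Pz
  ... | _ | yes refl | yes refl | _ = z , ≢-sym y≢z , ≢-sym x≢z , Pz

  avoiding-one : ThreeDistinct P → ∀ p → ∃[ a ] ∃[ b ] a ≢ b × a ≢ p × b ≢ p × P a × P b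
  avoiding-one three p with avoiding-two three p p
  ... | a , a≢p , _ , Pa with avoiding-two three p a
  ...   | b , b≢p , b≢a , Pb = a , b , ≢-sym b≢a , a≢p , b≢p , Pa , Pb

module _ {A : Set} {R : A → A → Set} where

  vertices : ∀ {x z} → Star R x z → List A
  vertices {x} ε = [ x ]
  vertices {x} (_ ◅ p) = x ∷ vertices p

  start∈vertices : ∀ {x z} (p : Star R x z) → x ∈ vertices p
  start∈vertices ε = here refl
  start∈vertices (_ ◅ _) = here refl

  ◅-linked : ∀ {w x z ys} → R w x → (p : Star R x z) → Linked R (z ∷ ys) →
             Linked R (w ∷ vertices p ++ ys)
  ◅-linked e ε l = e ∷ l
  ◅-linked e (e′ ◅ p) l = e ∷ ◅-linked e′ p l

  star-exit : ∀ {P : A → Set} → Decidable P → ∀ {x z} → P x → ¬ P z → Star R x z →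
              ∃[ u ] ∃[ w ] Star (λ a b → P a × R a b × P b) x u × P u × ¬ P w × R u w
  star-exit P? Px ¬Pz ε = contradiction Px ¬Pz
  star-exit P? {x} Px ¬Pz (_◅_ {j = y} e p) with P? y
  ... | no ¬Py = x , y , ε , Px , ¬Py , e
  ... | yes Py with star-exit P? Py ¬Pz p
  ...   | u , w , inside , Pu , ¬Pw , uw = u , w , (Px , e , Py) ◅ inside , Pu , ¬Pw , uw

  module _ (_≟_ : DecidableEquality A) where
    open DecMembership _≟_ using (_∈?_)

    private
      suffix : ∀ {x y z} (p : Star R y z) → x ∈ vertices p → Unique (vertices p) →
               ∃[ q ] Unique (vertices {x} {z} q) × vertices q ⊆ vertices p
      suffix ε (here refl) unique = ε , unique , id
      suffix (e ◅ p) (here refl) unique = e ◅ p , unique , id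
      suffix (e ◅ p) (there x∈p) (_ ∷ unique) with suffix p x∈p unique
      ... | q , unique-q , q⊆p = q , unique-q , there ∘ q⊆p

    simplify : ∀ {x z} (p : Star R x z) → ∃[ q ] Unique (vertices {x} {z} q) × vertices q ⊆ vertices p
    simplify ε = ε , [] ∷ [] , id
    simplify {x} (e ◅ p) with simplify p
    ... | q , unique-q , q⊆p with x ∈? vertices q
    ...   | no x∉q =
      e ◅ q , ¬Any⇒All¬ _ x∉q ∷ unique-q , λ { (here refl) → here refl ; (there s) → there (q⊆p s) }
    ...   | yes x∈q with suffix q x∈q unique-q
    ...     | q′ , unique-q′ , q′⊆q = q′ , unique-q′ , there ∘ q⊆p ∘ q′⊆q

∈-vertices-gmap⁻ : ∀ {A B : Set} {R : A → A → Set} {T : B → B → Set}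
                   (f : A → B) (g : ∀ {a b} → R a b → T (f a) (f b)) {x z s} (p : Star R x z) →
                   s ∈ vertices (gmap {T = R} {U = T} f g p) → ∃[ a ] Star R x a × s ≡ f a
∈-vertices-gmap⁻ f g ε (here refl) = _ , ε , refl
∈-vertices-gmap⁻ f g (e ◅ p) (here refl) = _ , ε , refl
∈-vertices-gmap⁻ f g (e ◅ p) (there s∈p) with ∈-vertices-gmap⁻ f g p s∈p
... | a , path , refl = a , e ◅ path , refl

module _ {A : Set} {R : A → A → Set} where

  Linked-++⁻ˡ : ∀ xs {ys} → Linked R (xs ++ ys) → Linked R xs
  Linked-++⁻ˡ [] _ = []
  Linked-++⁻ˡ (x ∷ []) _ = [-]
  Linked-++⁻ˡ (x ∷ y ∷ xs) (e ∷ l) = e ∷ Linked-++⁻ˡ (y ∷ xs) l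

  Linked-++⁻ʳ : ∀ xs {ys} → Linked R (xs ++ ys) → Linked R ys
  Linked-++⁻ʳ [] l = l
  Linked-++⁻ʳ (x ∷ []) [-] = []
  Linked-++⁻ʳ (x ∷ []) (_ ∷ l) = l
  Linked-++⁻ʳ (x ∷ y ∷ xs) (_ ∷ l) = Linked-++⁻ʳ (y ∷ xs) l

Unique-middle : ∀ {A : Set} {w : A} xs {ys} → Unique (xs ++ w ∷ ys) → w ∉ xs × w ∉ ys
Unique-middle [] (w∉ys ∷ _) = (λ ()) , All¬⇒¬Any w∉ys
Unique-middle (x ∷ xs) (x∉ ∷ unique) with Unique-middle xs unique
... | w∉xs , w∉ys =
  (λ { (here refl) → All.lookup x∉ (∈-++⁺ʳ xs (here refl)) refl ; (there w∈xs) → w∉xs w∈xs }) ,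
  w∉ys

module Blocks {n : ℕ} (G : Graph n) where
  open DecMembership (_≟ᶠ_ {n}) using (_∈?_)

  E-sym : ∀ {x y} → E G x y → E G y x
  E-sym {x} {y} e = trans (Graph.sym G y x) e

  E⇒≢ : ∀ {x y} → E G x y → x ≢ y
  E⇒≢ {x} e refl = contradiction (trans (sym e) (Graph.irref G x)) λ ()

  E? : ∀ x y → Dec (E G x y)
  E? x y = Graph.adj G x y Bool.≟ true

  ES-sym : ∀ {T x y} → ES G T x y → ES G T y x
  ES-sym (Tx , Ty , e) = Ty , Tx , E-sym e

  ∈-remove⁺ : ∀ S w {x} → S x ≡ true → x ≢ w → remove G S w x ≡ true
  ∈-remove⁺ S w {x} Sx x≢w with S x | x ≟ᶠ w
  ... | true | no _ = refl
  ... | true | yes x≡w = contradiction x≡w x≢w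

  ∈-remove⁻ : ∀ S w {x} → remove G S w x ≡ true → S x ≡ true × x ≢ w
  ∈-remove⁻ S w {x} _ with S x | x ≟ᶠ w
  ... | true | no x≢w = refl , x≢w

  TwoConnected : Sub G → Set
  TwoConnected S = ConnectedSub G S × NoCutVertex G S

  MaximalFor : (Sub G → Set) → Sub G → Set
  MaximalFor P S = P S × (∀ T → _⊆S_ G S T → P T → _⊆S_ G T S)

  private
    gap : Sub G → ℕ
    gap S = n ∸ ∣ tabulate S ∣

    ∈-tabulate : ∀ {S : Sub G} {x} → S x ≡ true → x Subset.∈ tabulate S
    ∈-tabulate {S} {x} Sx = lookup⇒[]= x (tabulate S) (trans (lookup∘tabulate S x) Sx)

    ∈-tabulate⁻ : ∀ {S : Sub G} {x} → x Subset.∈ tabulate S → S x ≡ true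
    ∈-tabulate⁻ {S} {x} x∈S = trans (sym (lookup∘tabulate S x)) ([]=⇒lookup x∈S)

    gap-⊂ : ∀ {S T x} → _⊆S_ G S T → T x ≡ true → S x ≡ false → gap T < gap S
    gap-⊂ {S} {T} {x} S⊆T Tx Sx = ∸-monoʳ-< (p⊂q⇒∣p∣<∣q∣ S⊂T) (∣p∣≤n (tabulate T))
      where
      S⊂T : tabulate S Subset.⊂ tabulate T
      S⊂T = (λ y∈S → ∈-tabulate {T} (S⊆T _ (∈-tabulate⁻ {S} y∈S))) , x , ∈-tabulate {T} Tx ,
            λ x∈S → contradiction (trans (sym (∈-tabulate⁻ {S} x∈S)) Sx) λ ()

    ProperSuperset : (Sub G → Set) → Sub G → Set
    ProperSuperset P S = ∃[ T ] _⊆S_ G S T × P T × ∃[ x ] T x ≡ true × S x ≡ false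

    no-proper-superset⇒maximal : ∀ {P} S → P S → ¬ ProperSuperset P S → MaximalFor P S
    no-proper-superset⇒maximal S PS none = PS , S-maximal
      where
      S-maximal : ∀ T → _⊆S_ G S T → _ → _⊆S_ G T S
      S-maximal T S⊆T PT x Tx with S x in Sx
      ... | true = refl
      ... | false = contradiction (T , S⊆T , PT , x , Tx , Sx) none

  ¬¬-maximal-⊇ : (P : Sub G → Set) → ∀ {S} → P S → ¬ ¬ (∃[ T ] _⊆S_ G S T × MaximalFor P T)
  ¬¬-maximal-⊇ P {S} = go (On.wellFounded gap <-wellFounded S)
    where
    go : ∀ {S} → Acc (_<_ on gap) S → P S → ¬ ¬ (∃[ T ] _⊆S_ G S T × MaximalFor P T)
    go {S} (acc smaller) PS no-maximal = ¬¬-excluded-middle {A = ProperSuperset P S} λ where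
      (yes (T , S⊆T , PT , x , Tx , Sx)) → go (smaller (gap-⊂ S⊆T Tx Sx)) PT λ where
        (M , T⊆M , M-maximal) → no-maximal (M , (λ y → T⊆M y ∘ S⊆T y) , M-maximal)
      (no none) → no-maximal (S , (λ _ Sy → Sy) , no-proper-superset⇒maximal S PS none)

  twoConnected⇒complete : BlockGraph G → ∀ {S} → TwoConnected S → IsComplete G S
  twoConnected⇒complete blockGraph S-twoConnected x y Sx Sy x≢y =
    decidable-stable (E? x y) λ ¬xy → ¬¬-maximal-⊇ TwoConnected S-twoConnected λ where
      (B , S⊆B , (B-connected , B-noCut) , B-maximal) →
        let B-block = B-connected , B-noCut , λ T B⊆T T-connected T-noCut →
                        B-maximal T B⊆T (T-connected , T-noCut)
        in ¬xy (blockGraph B B-block x y (S⊆B x Sx) (S⊆B y Sy) x≢y)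

  listSet : List (Fin n) → Sub G
  listSet l x = does (x ∈? l)

  listSet⁺ : ∀ {l x} → x ∈ l → listSet l x ≡ true
  listSet⁺ {l} {x} = dec-true (x ∈? l)

  listSet⁻ : ∀ {l x} → listSet l x ≡ true → x ∈ l
  listSet⁻ {l} {x} = does-true⁻ (x ∈? l)

  linked⇒connected : ∀ (T : Sub G) {l} → Linked (E G) l → (∀ {g} → g ∈ l → T g ≡ true) →
                     ∀ {x y} → x ∈ l → y ∈ l → Star (ES G T) x y
  linked⇒connected T {_ ∷ _} linked inT x∈ y∈ =
    reverse ES-sym (from-head linked inT x∈) ◅◅ from-head linked inT y∈
    where
    from-head : ∀ {h l x} → Linked (E G) (h ∷ l) → (∀ {g} → g ∈ h ∷ l → T g ≡ true) →
                x ∈ h ∷ l → Star (ES G T) h x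
    from-head _ inT (here refl) = ε
    from-head [-] inT (there ())
    from-head (e ∷ linked) inT (there x∈) =
      (inT (here refl) , inT (there (here refl)) , e) ◅ from-head linked (inT ∘ there) x∈

  private
    ∈-remove-listSet : ∀ {l w g} → g ∈ l → g ≢ w → remove G (listSet l) w g ≡ true
    ∈-remove-listSet {l} {w} g∈l = ∈-remove⁺ (listSet l) w (listSet⁺ g∈l)

    cycle-connected : ∀ c L → Linked (E G) (c ∷ L ++ [ c ]) → ConnectedSub G (listSet (c ∷ L))
    cycle-connected c L cycle =
      (c , listSet⁺ {c ∷ L} (here refl)) ,
      λ x y Sx Sy → linked⇒connected (listSet (c ∷ L)) (Linked-++⁻ˡ (c ∷ L) cycle) listSet⁺
                      (listSet⁻ Sx) (listSet⁻ Sy)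

    -- Removing w from the cycle c L₁ w L₂ c leaves the paths c L₁ and L₂ c, both through c.
    segment-to-start : ∀ c L₁ w L₂ → Linked (E G) (c ∷ L₁ ++ w ∷ L₂ ++ [ c ]) →
                       Unique (c ∷ L₁ ++ w ∷ L₂) →
                       ∀ {x} → x ∈ c ∷ L₁ ++ w ∷ L₂ → x ≢ w →
                       Star (ES G (remove G (listSet (c ∷ L₁ ++ w ∷ L₂)) w)) x c
    segment-to-start c L₁ w L₂ cycle unique x∈ x≢w
      with ∈-++⁻ (c ∷ L₁) x∈ | Unique-middle (c ∷ L₁) unique
    ... | inj₁ x∈front | w∉front , _ =
      linked⇒connected _ (Linked-++⁻ˡ (c ∷ L₁) cycle)
        (λ g∈ → ∈-remove-listSet (∈-++⁺ˡ g∈) λ { refl → w∉front g∈ })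
        x∈front (here refl)
    ... | inj₂ (here refl) | _ = contradiction refl x≢w
    ... | inj₂ (there x∈L₂) | w∉front , w∉L₂ =
      linked⇒connected _ (Linked-++⁻ʳ (w ∷ []) (Linked-++⁻ʳ (c ∷ L₁) cycle)) in-back
        (∈-++⁺ˡ x∈L₂) (∈-++⁺ʳ L₂ (here refl))
      where
      in-back : ∀ {g} → g ∈ L₂ ++ [ c ] → remove G (listSet (c ∷ L₁ ++ w ∷ L₂)) w g ≡ true
      in-back g∈ with ∈-++⁻ L₂ g∈
      ... | inj₁ g∈L₂ =
        ∈-remove-listSet (∈-++⁺ʳ (c ∷ L₁) (there g∈L₂)) λ { refl → w∉L₂ g∈L₂ }
      ... | inj₂ (here refl) =
        ∈-remove-listSet {c ∷ L₁ ++ w ∷ L₂} (here refl) λ { refl → w∉front (here refl) }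

    cycle-noCut : ∀ c L → Linked (E G) (c ∷ L ++ [ c ]) → Unique (c ∷ L) →
                  NoCutVertex G (listSet (c ∷ L))
    cycle-noCut c L cycle unique w (Sw , x , y , x∈ , y∈ , disconnected)
      with ∈-remove⁻ (listSet (c ∷ L)) w x∈ | ∈-remove⁻ (listSet (c ∷ L)) w y∈
         | listSet⁻ {c ∷ L} Sw
    ... | Sx , x≢w | Sy , y≢w | here refl =
      disconnected (linked⇒connected _ (Linked-++⁻ˡ L (Linked-++⁻ʳ (c ∷ []) cycle))
                      (λ g∈ → ∈-remove-listSet (there g∈)
                                λ { refl → Unique[x∷xs]⇒x∉xs unique g∈ })
                      (in-L Sx x≢w) (in-L Sy y≢w))
      where
      in-L : ∀ {g} → listSet (c ∷ L) g ≡ true → g ≢ c → g ∈ L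
      in-L Sg g≢c with listSet⁻ {c ∷ L} Sg
      ... | here refl = contradiction refl g≢c
      ... | there g∈L = g∈L
    ... | Sx , x≢w | Sy , y≢w | there w∈L with ∈-∃++ w∈L
    ...   | L₁ , L₂ , refl =
      disconnected (to-start (listSet⁻ Sx) x≢w ◅◅ reverse ES-sym (to-start (listSet⁻ Sy) y≢w))
      where
      to-start = segment-to-start c L₁ w L₂
                   (subst (λ l → Linked (E G) (c ∷ l)) (++-assoc L₁ (w ∷ L₂) [ c ]) cycle) unique

  cycle-clique : BlockGraph G → ∀ {a b c} (p : Star (E G) a b) → E G c a → E G b c →
                 Unique (c ∷ vertices p) →
                 ∀ {x y} → x ∈ c ∷ vertices p → y ∈ c ∷ vertices p → x ≢ y → E G x y
  cycle-clique blockGraph {c = c} p ca bc unique x∈ y∈ =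
    twoConnected⇒complete blockGraph
      (cycle-connected c (vertices p) cycle , cycle-noCut c (vertices p) cycle unique)
      _ _ (listSet⁺ x∈) (listSet⁺ y∈)
    where
    cycle = ◅-linked ca p (bc ∷ [-])

  square-diagonal : BlockGraph G → ∀ {a b c d} → E G a b → E G b c → E G c d → E G d a →
                    a ≢ c → b ≢ d → E G a c
  square-diagonal blockGraph ab bc cd da a≢c b≢d =
    cycle-clique blockGraph (bc ◅ cd ◅ ε) ab da
      ((E⇒≢ ab ∷ a≢c ∷ ≢-sym (E⇒≢ da) ∷ []) ∷ (E⇒≢ bc ∷ b≢d ∷ []) ∷ (E⇒≢ cd ∷ []) ∷
       [] ∷ [])
      (here refl) (there (there (here refl))) a≢c

module _ {D : MarkedGraph} where
  open MarkedGraph D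

  cutRank≤1-rectangle : ∀ {r side} → CutRank≤1 D r side →
                        ∀ {p u w w′} → InA D r side p → InA D r side u →
                        InB D r side w → InB D r side w′ →
                        U p w′ → U u w → U p w
  cutRank≤1-rectangle (f , g , cut) {p} {u} {w} {w′} Ap Au Bw Bw′ pw′ uw =
    Equivalence.from (cut p w Ap Bw) (cong₂ _∧_ fp gw)
    where
    fp : f p ≡ true
    fp = Bool.∧-conicalˡ (f p) (g w′) (Equivalence.to (cut p w′ Ap Bw′) pw′)
    gw : g w ≡ true
    gw = Bool.∧-conicalʳ (f u) (g w) (Equivalence.to (cut u w Au Bw) uw)

  star-bag-not-simplicial : DecidableEquality V → ∀ {r a q₁ q₂} → StarBag D r → InBag D r a →
                            (∀ {b c} → U a b → U a c → b ≢ c → U b c) →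
                            U a q₁ → U a q₂ → q₁ ≢ q₂ → ⊥
  star-bag-not-simplicial _≟_ {a = a} {q₁} {q₂}
    (c , _ , centre-adjacent , leaves-apart , l₁ , l₂ , l₁≢l₂ , l₁≢c , l₂≢c , rl₁ , rl₂)
    ra a-simplicial aq₁ aq₂ q₁≢q₂ with a ≟ c
  ... | yes refl = leaves-apart l₁ l₂ rl₁ rl₂ l₁≢c l₂≢c
                     (a-simplicial (centre-adjacent l₁ rl₁ l₁≢c) (centre-adjacent l₂ rl₂ l₂≢c)
                                   l₁≢l₂)
  ... | no a≢c with q₁ ≟ c
  ...   | no q₁≢c = leaves-apart a q₁ ra (ra ◅◅ return aq₁) a≢c q₁≢c aq₁
  ...   | yes refl = leaves-apart a q₂ ra (ra ◅◅ return aq₂) a≢c (≢-sym q₁≢q₂) aq₂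

module Realisations {n : ℕ} (G : Graph n) where
  open Blocks G

  -- ι x is the copy of x in D (an unmarked vertex), and Accessible p x says that an alternating
  -- path leads from p, through its marked edge, to ι x; in particular Accessible (ι x) = {x}.
  record Realisation (D : MarkedGraph) : Set₁ where
    open MarkedGraph D
    field
      _≟_ : DecidableEquality V
      ¬¬-decidable : (P : V → Set) → ¬ ¬ Decidable P
      U-sym : ∀ {p q} → U p q → U q p
      U-irrefl : ∀ {p} → ¬ U p p
      InBag? : ∀ p q → Dec (InBag D p q)
      ι : Fin n → V
      ι-unmarked : ∀ x → ¬ MarkedVertex D (ι x)
      unmarked⇒ι : ∀ p → ¬ MarkedVertex D p → ∃[ x ] p ≡ ι x
      Accessible : V → Fin n → Set
      ρ : V → Fin n
      ρ-accessible : ∀ p → Accessible p (ρ p)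
      ι-accessible : ∀ x → Accessible (ι x) x
      accessible-ι : ∀ {x y} → Accessible (ι x) y → y ≡ x
      E⇒U : ∀ {p q x y} → p ≢ q → InBag D p q → Accessible p x → Accessible q y → E G x y → U p q
      U⇒E : ∀ {p q x y} → p ≢ q → InBag D p q → Accessible p x → Accessible q y → U p q → E G x y
      accessible-≢ : ∀ {p q x y} → p ≢ q → InBag D p q → Accessible p x → Accessible q y → x ≢ y
      E⇒neighbour : ∀ {x y} → E G x y → ∃[ q ] U (ι x) q × Accessible q y
      bag-size : ∀ r → ThreeDistinct (InBag D r) ⊎ (∀ p → InBag D r p → ∃[ x ] p ≡ ι x)

    bag-edge : ∀ {p q} → U p q → InBag D p q
    bag-edge = return

    bag-sym : ∀ {p q} → InBag D p q → InBag D q p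
    bag-sym = reverse U-sym

    U⇒≢ : ∀ {p q} → U p q → p ≢ q
    U⇒≢ e refl = U-irrefl e

    ρ-E : ∀ {p q} → U p q → E G (ρ p) (ρ q)
    ρ-E e = U⇒E (U⇒≢ e) (bag-edge e) (ρ-accessible _) (ρ-accessible _) e

    ρ-≢ : ∀ {p q} → p ≢ q → InBag D p q → ρ p ≢ ρ q
    ρ-≢ p≢q pq = accessible-≢ p≢q pq (ρ-accessible _) (ρ-accessible _)

    U? : ∀ p q → Dec (U p q)
    U? p q with p ≟ q
    ... | yes refl = no U-irrefl
    ... | no p≢q with InBag? p q
    ...   | no ¬pq = no (¬pq ∘ bag-edge)
    ...   | yes pq = map′ (E⇒U p≢q pq (ρ-accessible p) (ρ-accessible q))
                          (U⇒E p≢q pq (ρ-accessible p) (ρ-accessible q)) (E? (ρ p) (ρ q))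

  base-realisation : Connected G → Realisation (baseMarked G)
  base-realisation connected = record
    { _≟_ = _≟ᶠ_
    ; ¬¬-decidable = ¬¬-decidable-Fin
    ; U-sym = E-sym
    ; U-irrefl = λ e → E⇒≢ e refl
    ; InBag? = λ p q → yes (Star.map (proj₂ ∘ proj₂) (proj₂ connected p q refl refl))
    ; ι = id
    ; ι-unmarked = λ _ ()
    ; unmarked⇒ι = λ p _ → p , refl
    ; Accessible = λ p y → y ≡ p
    ; ρ = id
    ; ρ-accessible = λ _ → refl
    ; ι-accessible = λ _ → refl
    ; accessible-ι = id
    ; E⇒U = λ { _ _ refl refl e → e }
    ; U⇒E = λ { _ _ refl refl e → e }
    ; accessible-≢ = λ { p≢q _ refl refl → p≢q }
    ; E⇒neighbour = λ {_} {y} e → y , e , refl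
    ; bag-size = λ _ → inj₂ λ p _ → p , refl
    }

  module SimpleStep {D : MarkedGraph} (R : Realisation D) (r : MarkedGraph.V D)
                    (side : MarkedGraph.V D → Bool) (split : IsSplitOfBag D r side) where
    open MarkedGraph D
    open Realisation R

    D′ : MarkedGraph
    D′ = simpleStep D r side

    open MarkedGraph D′ using () renaming (V to V′; U to U′)

    Side : Bool → V → Set
    Side t u = InBag D r u × side u ≡ t

    Side? : ∀ t → Decidable (Side t)
    Side? t u = InBag? r u ×-dec (side u Bool.≟ t)

    opposite-sides : ∀ {t u w} → Side t u → Side (not t) w → u ≢ w
    opposite-sides (_ , su) (_ , sw) refl = Bool.not-¬ su sw

    two-on-side : ∀ t → ∃[ x ] ∃[ y ] x ≢ y × Side t x × Side t y
    two-on-side true = proj₁ split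
    two-on-side false = proj₁ (proj₂ split)

    one-on-side : ∀ t → ∃[ x ] Side t x
    one-on-side t with two-on-side t
    ... | x , _ , _ , Sx , _ = x , Sx

    U′-inj₁ : ∀ {p q} → (InBag D r p → side p ≡ side q) → U p q → U′ (inj₁ p) (inj₁ q)
    U′-inj₁ agree e =
      e , (λ { ((rp , sp) , (_ , sq)) → Bool.not-¬ (trans (sym (agree rp)) sp) sq })
        , (λ { ((rp , sp) , (_ , sq)) → Bool.not-¬ (trans (sym (agree rp)) sp) sq })

    U′-marker : ∀ t {p w} → Side t p → Side (not t) w → U p w → U′ (inj₁ p) (inj₂ t)
    U′-marker true Sp Sw e = Sp , _ , Sw , e
    U′-marker false Sp Sw e = Sp , _ , Sw , e

    U′-marker⁻ : ∀ t {p} → U′ (inj₁ p) (inj₂ t) → Side t p × ∃[ w ] Side (not t) w × U p w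
    U′-marker⁻ true e = e
    U′-marker⁻ false e = e

    U′-sym : ∀ {p q} → U′ p q → U′ q p
    U′-sym {inj₁ x} {inj₁ y} (e , n₁ , n₂) =
      U-sym e , (λ { (a , b) → n₂ (b , a) }) , (λ { (a , b) → n₁ (b , a) })
    U′-sym {inj₁ x} {inj₂ true} e = e
    U′-sym {inj₁ x} {inj₂ false} e = e
    U′-sym {inj₂ true} {inj₁ y} e = e
    U′-sym {inj₂ false} {inj₁ y} e = e

    U′-irrefl : ∀ {p} → ¬ U′ p p
    U′-irrefl {inj₁ x} (e , _) = U-irrefl e
    U′-irrefl {inj₂ true} ()
    U′-irrefl {inj₂ false} ()

    exit-side : ∀ t {x b} → Side t x → Side (not t) b → Star U x b →
                ∃[ u ] ∃[ w ] Star U′ (inj₁ x) (inj₁ u) × Side t u × Side (not t) w × U u w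
    exit-side t Sx Sb path with star-exit (Side? t) Sx (λ Sb′ → opposite-sides Sb′ Sb refl) path
    ... | u , w , inside , Su@(ru , _) , ¬Sw , e =
      u , w , gmap inj₁ (λ { (Sa , e , Sb) → U′-inj₁ (λ _ → trans (proj₂ Sa) (sym (proj₂ Sb))) e })
                   inside ,
      Su , (ru ◅◅ bag-edge e , Bool.¬-not (λ sw → ¬Sw (ru ◅◅ bag-edge e , sw))) , e

    crossing-edge : ∀ t → ∃[ u ] ∃[ w ] Side t u × Side (not t) w × U u w
    crossing-edge t with one-on-side t | one-on-side (not t)
    ... | a , Sa | b , Sb with exit-side t Sa Sb (bag-sym (proj₁ Sa) ◅◅ proj₁ Sb)
    ...   | u , w , _ , Su , Sw , e = u , w , Su , Sw , e

    marker-reachable : ∀ t {x} → Side t x → InBag D′ (inj₁ x) (inj₂ t)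
    marker-reachable t Sx with one-on-side (not t)
    ... | b , Sb with exit-side t Sx Sb (bag-sym (proj₁ Sx) ◅◅ proj₁ Sb)
    ...   | u , w , path , Su , Sw , e = path ◅◅ return (U′-marker t Su Sw e)

    outside-lift : ∀ {x y} → ¬ InBag D r x → InBag D x y → InBag D′ (inj₁ x) (inj₁ y)
    outside-lift ¬rx ε = ε
    outside-lift ¬rx (e ◅ path) =
      U′-inj₁ (λ rx → contradiction rx ¬rx) e ◅
      outside-lift (λ ry → ¬rx (ry ◅◅ bag-sym (bag-edge e))) path

    -- The bags of D′: those of D other than the bag of r, and each side of the split together
    -- with its new marker vertex.
    SameBag′ : V′ → V′ → Set
    SameBag′ (inj₁ x) (inj₁ y) = InBag D x y × (InBag D r x → side x ≡ side y)
    SameBag′ (inj₁ x) (inj₂ t) = Side t x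
    SameBag′ (inj₂ t) (inj₁ y) = Side t y
    SameBag′ (inj₂ t) (inj₂ t′) = t ≡ t′

    SameBag′-refl : ∀ {p} → SameBag′ p p
    SameBag′-refl {inj₁ x} = ε , λ _ → refl
    SameBag′-refl {inj₂ t} = refl

    SameBag′-trans : ∀ {p q s} → SameBag′ p q → SameBag′ q s → SameBag′ p s
    SameBag′-trans {inj₁ x} {inj₁ y} {inj₁ z} (xy , a₁) (yz , a₂) =
      xy ◅◅ yz , λ rx → trans (a₁ rx) (a₂ (rx ◅◅ xy))
    SameBag′-trans {inj₁ x} {inj₁ y} {inj₂ t} (xy , a) (ry , sy) =
      ry ◅◅ bag-sym xy , trans (a (ry ◅◅ bag-sym xy)) sy
    SameBag′-trans {inj₁ x} {inj₂ t} {inj₁ z} (rx , sx) (rz , sz) =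
      bag-sym rx ◅◅ rz , λ _ → trans sx (sym sz)
    SameBag′-trans {inj₁ x} {inj₂ t} {inj₂ t′} Sx refl = Sx
    SameBag′-trans {inj₂ t} {inj₁ y} {inj₁ z} (ry , sy) (yz , a) = ry ◅◅ yz , trans (sym (a ry)) sy
    SameBag′-trans {inj₂ t} {inj₁ y} {inj₂ t′} (_ , sy) (_ , sy′) = trans (sym sy) sy′
    SameBag′-trans {inj₂ t} {inj₂ t′} {inj₁ z} refl Sz = Sz
    SameBag′-trans {inj₂ t} {inj₂ t′} {inj₂ t″} refl refl = refl

    same-side : ∀ {x y} → InBag D r x → InBag D r y →
                ¬ (Side true x × Side false y) → ¬ (Side false x × Side true y) → side x ≡ side y
    same-side {x} {y} rx ry n₁ n₂ with side x | side y
    ... | true | true = refl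
    ... | false | false = refl
    ... | true | false = contradiction ((rx , refl) , (ry , refl)) n₁
    ... | false | true = contradiction ((rx , refl) , (ry , refl)) n₂

    U′⇒SameBag′ : ∀ {p q} → U′ p q → SameBag′ p q
    U′⇒SameBag′ {inj₁ x} {inj₁ y} (e , n₁ , n₂) =
      bag-edge e , λ rx → same-side rx (rx ◅◅ bag-edge e) n₁ n₂
    U′⇒SameBag′ {inj₁ x} {inj₂ t} e = proj₁ (U′-marker⁻ t e)
    U′⇒SameBag′ {inj₂ t} {inj₁ y} e = proj₁ (U′-marker⁻ t (U′-sym {inj₂ t} e))
    U′⇒SameBag′ {inj₂ true} {inj₂ _} ()
    U′⇒SameBag′ {inj₂ false} {inj₂ _} ()

    InBag′⇒SameBag′ : ∀ {p q} → InBag D′ p q → SameBag′ p q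
    InBag′⇒SameBag′ ε = SameBag′-refl
    InBag′⇒SameBag′ (e ◅ path) = SameBag′-trans (U′⇒SameBag′ e) (InBag′⇒SameBag′ path)

    SameBag′⇒InBag′ : ∀ {p q} → SameBag′ p q → InBag D′ p q
    SameBag′⇒InBag′ {inj₁ x} {inj₁ y} (xy , agree) with InBag? r x
    ... | yes rx = marker-reachable (side x) (rx , refl) ◅◅
                   reverse U′-sym (marker-reachable (side x) (rx ◅◅ xy , sym (agree rx)))
    ... | no ¬rx = outside-lift ¬rx xy
    SameBag′⇒InBag′ {inj₁ x} {inj₂ t} Sx = marker-reachable t Sx
    SameBag′⇒InBag′ {inj₂ t} {inj₁ y} Sy = reverse U′-sym (marker-reachable t Sy)
    SameBag′⇒InBag′ {inj₂ t} {inj₂ t} refl = ε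

    SameBag′? : ∀ p q → Dec (SameBag′ p q)
    SameBag′? (inj₁ x) (inj₁ y) = InBag? x y ×-dec (InBag? r x →-dec (side x Bool.≟ side y))
    SameBag′? (inj₁ x) (inj₂ t) = Side? t x
    SameBag′? (inj₂ t) (inj₁ y) = Side? t y
    SameBag′? (inj₂ t) (inj₂ t′) = t Bool.≟ t′

    -- The marker on side t reaches G through the marked edge to the other marker, which is
    -- adjacent to the vertices on the other side having a neighbour on side t.
    Accessible′ : V′ → Fin n → Set
    Accessible′ (inj₁ p) = Accessible p
    Accessible′ (inj₂ t) y = ∃[ w ] Side (not t) w × (∃[ u ] Side t u × U u w) × Accessible w y

    ρ′ : V′ → Fin n
    ρ′ (inj₁ p) = ρ p
    ρ′ (inj₂ t) = ρ (proj₁ (proj₂ (crossing-edge t)))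

    ρ′-accessible : ∀ p → Accessible′ p (ρ′ p)
    ρ′-accessible (inj₁ p) = ρ-accessible p
    ρ′-accessible (inj₂ t) =
      let (u , w , Su , Sw , e) = crossing-edge t in w , Sw , (u , Su , e) , ρ-accessible w

    rectangle : ∀ t {p u w w′} → Side t p → Side t u → Side (not t) w → Side (not t) w′ →
                U p w′ → U u w → U p w
    rectangle true = cutRank≤1-rectangle {D = D} {r} {side} (proj₂ (proj₂ split))
    rectangle false Sp Su Sw Sw′ pw′ uw =
      U-sym (cutRank≤1-rectangle {D = D} {r} {side} (proj₂ (proj₂ split))
                                 Sw Sw′ Sp Su (U-sym uw) (U-sym pw′))

    marker-separation : ∀ t {p u w x y} → Side t p → Side t u → Side (not t) w → U u w →
                        Accessible p x → Accessible w y →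
                        (E G x y → U′ (inj₁ p) (inj₂ t)) × (U′ (inj₁ p) (inj₂ t) → E G x y) × x ≢ y
    marker-separation t Sp Su Sw uw ax ay =
      (λ e → U′-marker t Sp Sw (E⇒U p≢w pw ax ay e)) ,
      (λ e → let (_ , w′ , Sw′ , pw′) = U′-marker⁻ t e in
             U⇒E p≢w pw ax ay (rectangle t Sp Su Sw Sw′ pw′ uw)) ,
      accessible-≢ p≢w pw ax ay
      where
      p≢w = opposite-sides Sp Sw
      pw = bag-sym (proj₁ Sp) ◅◅ proj₁ Sw

    separation′ : ∀ {p q x y} → p ≢ q → SameBag′ p q → Accessible′ p x → Accessible′ q y →
                  (E G x y → U′ p q) × (U′ p q → E G x y) × x ≢ y
    separation′ {inj₁ p} {inj₁ q} p≢q (pq , agree) ax ay =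
      U′-inj₁ agree ∘ E⇒U p≢q′ pq ax ay ,
      U⇒E p≢q′ pq ax ay ∘ proj₁ ,
      accessible-≢ p≢q′ pq ax ay
      where
      p≢q′ = p≢q ∘ cong inj₁
    separation′ {inj₁ p} {inj₂ t} _ Sp ax (w , Sw , (u , Su , uw) , ay) =
      marker-separation t Sp Su Sw uw ax ay
    separation′ {inj₂ t} {inj₁ q} _ Sq (w , Sw , (u , Su , uw) , ax) ay
      with marker-separation t Sq Su Sw uw ay ax
    ... | E⇒U′ , U′⇒E , y≢x =
      (λ e → U′-sym {inj₁ q} (E⇒U′ (E-sym e))) ,
      (λ e → E-sym (U′⇒E (U′-sym {inj₂ t} e))) ,
      ≢-sym y≢x
    separation′ {inj₂ t} {inj₂ t} p≢q refl = contradiction refl p≢q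

    E⇒neighbour′ : ∀ {x y} → E G x y → ∃[ q ] U′ (inj₁ (ι x)) q × Accessible′ q y
    E⇒neighbour′ {x} xy with E⇒neighbour xy
    ... | q , e , ay with InBag? r (ι x)
    ...   | no ¬rx = inj₁ q , U′-inj₁ (λ rx → contradiction rx ¬rx) e , ay
    ...   | yes rx with side q Bool.≟ side (ι x)
    ...     | yes same = inj₁ q , U′-inj₁ (λ _ → sym same) e , ay
    ...     | no differ =
      let Sx = rx , refl ; Sq = rx ◅◅ bag-edge e , Bool.¬-not differ in
      inj₂ (side (ι x)) , U′-marker _ Sx Sq e , q , Sq , (ι x , Sx , e) , ay

    marker-bag-three : ∀ t → ThreeDistinct (InBag D′ (inj₂ t))
    marker-bag-three t with two-on-side t
    ... | a , b , a≢b , Sa , Sb =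
      inj₂ t , inj₁ a , inj₁ b , (λ ()) , a≢b ∘ inj₁-injective , (λ ()) ,
      ε , SameBag′⇒InBag′ {inj₂ t} {inj₁ a} Sa , SameBag′⇒InBag′ {inj₂ t} {inj₁ b} Sb

    bag-size′ : ∀ r′ → ThreeDistinct (InBag D′ r′) ⊎ (∀ p → InBag D′ r′ p → ∃[ x ] p ≡ inj₁ (ι x))
    bag-size′ (inj₂ t) = inj₁ (marker-bag-three t)
    bag-size′ (inj₁ s) with InBag? r s
    ... | yes rs = inj₁ (ThreeDistinct-map {f = id} id (marker-reachable (side s) (rs , refl) ◅◅_)
                                           (marker-bag-three (side s)))
    ... | no ¬rs with bag-size s
    ...   | inj₁ three = inj₁ (ThreeDistinct-map inj₁-injective (outside-lift ¬rs) three)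
    ...   | inj₂ all-ι = inj₂ λ p sp → image-of-ι p (InBag′⇒SameBag′ sp)
      where
      image-of-ι : ∀ p → SameBag′ (inj₁ s) p → ∃[ x ] p ≡ inj₁ (ι x)
      image-of-ι (inj₁ p) (sp , _) with all-ι p sp
      ... | x , refl = x , refl
      image-of-ι (inj₂ t) (rs , _) = contradiction rs ¬rs

    unmarked⇒ι′ : ∀ p → ¬ MarkedVertex D′ p → ∃[ x ] p ≡ inj₁ (ι x)
    unmarked⇒ι′ (inj₁ p) unmarked with unmarked⇒ι p (λ { (w , m) → unmarked (inj₁ w , m) })
    ... | x , refl = x , refl
    unmarked⇒ι′ (inj₂ true) unmarked = contradiction (inj₂ false , tt) unmarked
    unmarked⇒ι′ (inj₂ false) unmarked = contradiction (inj₂ true , tt) unmarked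

    ι-unmarked′ : ∀ x → ¬ MarkedVertex D′ (inj₁ (ι x))
    ι-unmarked′ x (inj₁ w , m) = ι-unmarked x (w , m)

    realisation′ : Realisation D′
    realisation′ = record
      { _≟_ = ⊎-≡-dec _≟_ Bool._≟_
      ; ¬¬-decidable = ¬¬-decidable-⊎ ¬¬-decidable ¬¬-decidable-Bool
      ; U-sym = λ {p} {q} → U′-sym {p} {q}
      ; U-irrefl = λ {p} → U′-irrefl {p}
      ; InBag? = λ p q → map′ SameBag′⇒InBag′ InBag′⇒SameBag′ (SameBag′? p q)
      ; ι = inj₁ ∘ ι
      ; ι-unmarked = ι-unmarked′
      ; unmarked⇒ι = unmarked⇒ι′
      ; Accessible = Accessible′
      ; ρ = ρ′
      ; ρ-accessible = ρ′-accessible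
      ; ι-accessible = ι-accessible
      ; accessible-ι = accessible-ι
      ; E⇒U = λ p≢q pq ax ay → proj₁ (separation′ p≢q (InBag′⇒SameBag′ pq) ax ay)
      ; U⇒E = λ p≢q pq ax ay → proj₁ (proj₂ (separation′ p≢q (InBag′⇒SameBag′ pq) ax ay))
      ; accessible-≢ = λ p≢q pq ax ay →
          proj₂ (proj₂ (separation′ p≢q (InBag′⇒SameBag′ pq) ax ay))
      ; E⇒neighbour = E⇒neighbour′
      ; bag-size = bag-size′
      }

  realisation : Connected G → ∀ {D} → SplitDecomposition G D → Realisation D
  realisation connected base = base-realisation connected
  realisation connected (step d r side split) = SimpleStep.realisation′ (realisation connected d) r side split

module Decomposition {n : ℕ} {G : Graph n} (blockGraph : BlockGraph G)
                     {D : MarkedGraph} (R : Realisations.Realisation G D) where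
  open Blocks G
  open MarkedGraph D
  open Realisations.Realisation R

  module _ {r v} (complete : CompleteBag D r) (three : ThreeDistinct (InBag D r)) (rv̂ : InBag D r (ι v)) where

    private
      accessible-adjacent : ∀ {a b x y} → InBag D r a → InBag D r b → a ≢ b →
                            Accessible a x → Accessible b y → E G x y
      accessible-adjacent ra rb a≢b ax ay = U⇒E a≢b (bag-sym ra ◅◅ rb) ax ay (complete _ _ ra rb a≢b)

    complete-bag⇒simplicial : Simplicial G v
    complete-bag⇒simplicial y z vy vz y≢z with E⇒neighbour vy | E⇒neighbour vz
    ... | qy , v̂qy , ay | qz , v̂qz , az with qy ≟ qz
    ...   | no qy≢qz = accessible-adjacent rqy (rv̂ ◅◅ bag-edge v̂qz) qy≢qz ay az
      where
      rqy = rv̂ ◅◅ bag-edge v̂qy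
    ...   | yes refl with avoiding-two _≟_ three (ι v) qy
    ...     | c , c≢v̂ , c≢q , rc =
      square-diagonal blockGraph (ρc-adjacent ay) (E-sym (ρc-adjacent az)) (E-sym vz) vy y≢z ρc≢v
      where
      rqy = rv̂ ◅◅ bag-edge v̂qy
      ρc-adjacent : ∀ {x} → Accessible qy x → E G x (ρ c)
      ρc-adjacent ax = accessible-adjacent rqy rc (≢-sym c≢q) ax (ρ-accessible c)
      ρc≢v : ρ c ≢ v
      ρc≢v = accessible-≢ c≢v̂ (bag-sym rc ◅◅ rv̂) (ρ-accessible c) (ι-accessible v)

    complete-bag⇒two-neighbours : ∃[ x ] ∃[ y ] x ≢ y × E G v x × E G v y
    complete-bag⇒two-neighbours with avoiding-one _≟_ three (ι v)
    ... | a , b , a≢b , a≢v̂ , b≢v̂ , ra , rb =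
      ρ a , ρ b , ρ-≢ a≢b (bag-sym ra ◅◅ rb) ,
      accessible-adjacent rv̂ ra (≢-sym a≢v̂) (ι-accessible v) (ρ-accessible a) ,
      accessible-adjacent rv̂ rb (≢-sym b≢v̂) (ι-accessible v) (ρ-accessible b)

  bigCompleteBag⇒simplicial : HasBigCompleteBagWithUnmarked D → HasSimplicialOfDegree≥2 G
  bigCompleteBag⇒simplicial (r , complete , three , u , ru , unmarked) with unmarked⇒ι u unmarked
  ... | v , refl = v , complete-bag⇒simplicial complete three ru , complete-bag⇒two-neighbours complete three ru

  module SimplicialVertex (bag-types : ∀ r → PrimeBag D r ⊎ StarBag D r ⊎ CompleteBag D r)
                          {v} (v-simplicial : Simplicial G v)
                          {y z} (y≢z : y ≢ z) (vy : E G v y) (vz : E G v z) where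

    v̂ : V
    v̂ = ι v

    ClosedNeighbour : V → Set
    ClosedNeighbour q = q ≡ v̂ ⊎ U v̂ q

    ClosedNeighbour? : Decidable ClosedNeighbour
    ClosedNeighbour? q = (q ≟ v̂) ⊎-dec U? v̂ q

    private
      v̂-U⇒E : ∀ {q} → U v̂ q → E G v (ρ q)
      v̂-U⇒E e = U⇒E (U⇒≢ e) (bag-edge e) (ι-accessible v) (ρ-accessible _) e

      v̂-E⇒U : ∀ {q} → InBag D v̂ q → q ≢ v̂ → E G v (ρ q) → U v̂ q
      v̂-E⇒U v̂q q≢v̂ = E⇒U (≢-sym q≢v̂) v̂q (ι-accessible v) (ρ-accessible _)

      v≢ρ : ∀ {q} → InBag D v̂ q → q ≢ v̂ → v ≢ ρ q
      v≢ρ v̂q q≢v̂ = accessible-≢ (≢-sym q≢v̂) v̂q (ι-accessible v) (ρ-accessible _)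

    neighbours-adjacent : ∀ {a b} → U v̂ a → U v̂ b → a ≢ b → U a b
    neighbours-adjacent v̂a v̂b a≢b =
      E⇒U a≢b ab (ρ-accessible _) (ρ-accessible _)
          (v-simplicial _ _ (v̂-U⇒E v̂a) (v̂-U⇒E v̂b) (ρ-≢ a≢b ab))
      where
      ab = bag-sym (bag-edge v̂a) ◅◅ bag-edge v̂b

    closed-neighbourhood-clique : ∀ {a b} → ClosedNeighbour a → ClosedNeighbour b → a ≢ b → U a b
    closed-neighbourhood-clique (inj₁ refl) (inj₁ refl) a≢b = contradiction refl a≢b
    closed-neighbourhood-clique (inj₁ refl) (inj₂ v̂b) _ = v̂b
    closed-neighbourhood-clique (inj₂ v̂a) (inj₁ refl) _ = U-sym v̂a
    closed-neighbourhood-clique (inj₂ v̂a) (inj₂ v̂b) = neighbours-adjacent v̂a v̂b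

    beyond-closed-neighbourhood : ∀ {p q} → InBag D v̂ p → InBag D v̂ q → p ≢ q → ¬ U p q →
                                  ∃[ t ] InBag D v̂ t × ¬ ClosedNeighbour t
    beyond-closed-neighbourhood {p} {q} v̂p v̂q p≢q ¬pq with ClosedNeighbour? p | ClosedNeighbour? q
    ... | no ¬Np | _ = p , v̂p , ¬Np
    ... | yes _ | no ¬Nq = q , v̂q , ¬Nq
    ... | yes Np | yes Nq = contradiction (closed-neighbourhood-clique Np Nq p≢q) ¬pq

    leaving-edge : ∀ {t} → InBag D v̂ t → ¬ ClosedNeighbour t →
                   ∃[ q ] ∃[ w ] U v̂ q × InBag D v̂ w × ¬ ClosedNeighbour w × U q w
    leaving-edge v̂t ¬Nt with star-exit ClosedNeighbour? (inj₁ refl) ¬Nt v̂t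
    ... | u , w , _ , inj₁ refl , ¬Nw , e = contradiction (inj₂ e) ¬Nw
    ... | u , w , _ , inj₂ v̂u , ¬Nw , e = u , w , v̂u , bag-edge v̂u ◅◅ bag-edge e , ¬Nw , e

    module LeavingEdge {q₁ w} (v̂q₁ : U v̂ q₁) (v̂w : InBag D v̂ w) (¬Nw : ¬ ClosedNeighbour w)
                       (q₁w : U q₁ w) where

      w≢v̂ : w ≢ v̂
      w≢v̂ = ¬Nw ∘ inj₁

      v≢ρw : v ≢ ρ w
      v≢ρw = v≢ρ v̂w w≢v̂

      ¬v-ρw : ¬ E G v (ρ w)
      ¬v-ρw = ¬Nw ∘ inj₂ ∘ v̂-E⇒U v̂w w≢v̂

      ρw-adjacent : ∀ {x} → Accessible q₁ x → E G x (ρ w)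
      ρw-adjacent ax = U⇒E (U⇒≢ q₁w) (bag-edge q₁w) ax (ρ-accessible w) q₁w

      unique-neighbour-impossible : ¬ (∀ {q} → U v̂ q → q ≡ q₁)
      unique-neighbour-impossible only with E⇒neighbour vy | E⇒neighbour vz
      ... | qy , v̂qy , ay | qz , v̂qz , az with only v̂qy | only v̂qz
      ...   | refl | refl =
        ¬v-ρw (square-diagonal blockGraph vy (ρw-adjacent ay) (E-sym (ρw-adjacent az)) (E-sym vz) v≢ρw y≢z)

      Component : V → Set
      Component = Star (λ a b → U a b × ¬ ClosedNeighbour b) w

      component-outside : ∀ {s} → Component s → ¬ ClosedNeighbour s
      component-outside = go ¬Nw
        where
        go : ∀ {a s} → ¬ ClosedNeighbour a → Star (λ a b → U a b × ¬ ClosedNeighbour b) a s →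
             ¬ ClosedNeighbour s
        go ¬Na ε = ¬Na
        go _ ((_ , ¬Nb) ◅ path) = go ¬Nb path

      component-in-bag : ∀ {s} → Component s → InBag D v̂ s
      component-in-bag path = v̂w ◅◅ Star.map proj₁ path

      -- A simple path from ρ w to ρ x through the component closes, via ρ y, v and ρ q₁, a cycle
      -- of G; its vertex set is a clique, so v would be adjacent to ρ w.
      component-avoids-neighbours : ∀ {x y} → Component x → U v̂ y → y ≢ q₁ → ¬ U x y
      component-avoids-neighbours {x} {y} path v̂y y≢q₁ xy =
        ¬v-ρw (cycle-clique blockGraph (v̂-U⇒E v̂q₁ ◅ ρ-E q₁w ◅ simple) (E-sym (v̂-U⇒E v̂y)) (ρ-E xy)
                 unique (there (here refl)) (there (there (there (start∈vertices simple)))) v≢ρw)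
        where
        simplified = simplify _≟ᶠ_ (gmap ρ (ρ-E ∘ proj₁) path)
        simple = proj₁ simplified

        avoids-ends : ∀ {g} → g ∈ vertices simple → g ≢ v × g ≢ ρ q₁ × g ≢ ρ y
        avoids-ends g∈ with ∈-vertices-gmap⁻ ρ (ρ-E ∘ proj₁) path (proj₂ (proj₂ simplified) g∈)
        ... | s , ws , refl =
          ≢-sym (v≢ρ v̂s (λ { refl → outside (inj₁ refl) })) ,
          ρ-≢ (λ { refl → outside (inj₂ v̂q₁) }) (bag-sym v̂s ◅◅ bag-edge v̂q₁) ,
          ρ-≢ (λ { refl → outside (inj₂ v̂y) }) (bag-sym v̂s ◅◅ bag-edge v̂y)
          where
          outside = component-outside ws
          v̂s = component-in-bag ws

        unique : Unique (ρ y ∷ v ∷ ρ q₁ ∷ vertices simple)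
        unique =
          (≢-sym (v≢ρ (bag-edge v̂y) (≢-sym (U⇒≢ v̂y))) ∷
           ρ-≢ y≢q₁ (bag-sym (bag-edge v̂y) ◅◅ bag-edge v̂q₁) ∷
           All.tabulate (≢-sym ∘ proj₂ ∘ proj₂ ∘ avoids-ends)) ∷
          (v≢ρ (bag-edge v̂q₁) (≢-sym (U⇒≢ v̂q₁)) ∷ All.tabulate (≢-sym ∘ proj₁ ∘ avoids-ends)) ∷
          All.tabulate (≢-sym ∘ proj₁ ∘ proj₂ ∘ avoids-ends) ∷
          proj₁ (proj₂ simplified)

      component-closed : ∀ {x y} → Component x → U x y → y ≢ q₁ → Component y
      component-closed {y = y} path xy y≢q₁ with ClosedNeighbour? y
      ... | no ¬Ny = path ◅◅ return (xy , ¬Ny)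
      ... | yes (inj₁ refl) = contradiction (inj₂ (U-sym xy)) (component-outside path)
      ... | yes (inj₂ v̂y) = contradiction xy (component-avoids-neighbours path v̂y y≢q₁)

      -- q₁ is a cut vertex of the bag, separating its branch q₁ ∪ Component from v̂.
      Branch : V → Set
      Branch s = s ≡ q₁ ⊎ Component s

      module _ {q₂} (v̂q₂ : U v̂ q₂) (q₂≢q₁ : q₂ ≢ q₁) (Component? : Decidable Component) where

        private
          Branch? : Decidable Branch
          Branch? s = (s ≟ q₁) ⊎-dec Component? s

          branch-cut : ∀ x y → Branch x → ¬ Branch y → InBag D x y →
                       (U x y ⇔ (does (x ≟ q₁) ∧ Graph.adj G (ρ q₁) (ρ y) ≡ true))
          branch-cut x y Bx ¬By xy with x ≟ q₁ | Bx
          ... | yes refl | _ =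
            mk⇔ (U⇒E q₁≢y xy (ρ-accessible _) (ρ-accessible _))
                (E⇒U q₁≢y xy (ρ-accessible _) (ρ-accessible _))
            where
            q₁≢y : q₁ ≢ y
            q₁≢y = ¬By ∘ inj₁ ∘ sym
          ... | no x≢q₁ | inj₁ x≡q₁ = contradiction x≡q₁ x≢q₁
          ... | no _ | inj₂ Cx =
            mk⇔ (λ xy → contradiction (inj₂ (component-closed Cx xy (¬By ∘ inj₁))) ¬By) λ ()

        branch-split : IsSplitOfBag D v̂ (λ s → does (Branch? s))
        branch-split =
          (q₁ , w , U⇒≢ q₁w , (bag-edge v̂q₁ , dec-true (Branch? q₁) (inj₁ refl)) ,
                               (v̂w , dec-true (Branch? w) (inj₂ ε))) ,
          (v̂ , q₂ , U⇒≢ v̂q₂ , (ε , dec-false (Branch? v̂) v̂∉) ,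
                               (bag-edge v̂q₂ , dec-false (Branch? q₂) q₂∉)) ,
          (λ s → does (s ≟ q₁)) , (λ s → Graph.adj G (ρ q₁) (ρ s)) ,
          λ x y (v̂x , sx) (v̂y , sy) →
            branch-cut x y (does-true⁻ (Branch? x) sx) (does-false⁻ (Branch? y) sy) (bag-sym v̂x ◅◅ v̂y)
          where
          v̂∉ : ¬ Branch v̂
          v̂∉ (inj₁ v̂≡q₁) = U⇒≢ v̂q₁ v̂≡q₁
          v̂∉ (inj₂ Cv̂) = component-outside Cv̂ (inj₁ refl)
          q₂∉ : ¬ Branch q₂
          q₂∉ (inj₁ q₂≡q₁) = q₂≢q₁ q₂≡q₁
          q₂∉ (inj₂ Cq₂) = component-outside Cq₂ (inj₂ v̂q₂)

      second-neighbour-impossible : ∀ {q₂} → U v̂ q₂ → q₂ ≢ q₁ → ⊥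
      second-neighbour-impossible v̂q₂ q₂≢q₁ with bag-types v̂
      ... | inj₁ prime =
        ¬¬-decidable Component λ Component? → prime (_ , branch-split v̂q₂ q₂≢q₁ Component?)
      ... | inj₂ (inj₁ star) =
        star-bag-not-simplicial {D = D} _≟_ star ε neighbours-adjacent v̂q₁ v̂q₂ (≢-sym q₂≢q₁)
      ... | inj₂ (inj₂ complete) = ¬Nw (inj₂ (complete v̂ w ε v̂w (≢-sym w≢v̂)))

      impossible : ⊥
      impossible = ¬¬-excluded-middle {A = ∃[ q₂ ] U v̂ q₂ × q₂ ≢ q₁} λ where
        (yes (q₂ , v̂q₂ , q₂≢q₁)) → second-neighbour-impossible v̂q₂ q₂≢q₁
        (no no-second) → unique-neighbour-impossible λ {q} v̂q →
          decidable-stable (q ≟ q₁) λ q≢q₁ → no-second (q , v̂q , q≢q₁)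

    bag-complete : CompleteBag D v̂
    bag-complete p q v̂p v̂q p≢q = decidable-stable (U? p q) λ ¬pq →
      let (t , v̂t , ¬Nt) = beyond-closed-neighbourhood v̂p v̂q p≢q ¬pq
          (q₁ , w , v̂q₁ , v̂w , ¬Nw , q₁w) = leaving-edge v̂t ¬Nt
      in LeavingEdge.impossible v̂q₁ v̂w ¬Nw q₁w

    bag-three : ThreeDistinct (InBag D v̂)
    bag-three with bag-size v̂
    ... | inj₁ three = three
    ... | inj₂ all-ι with E⇒neighbour vy | E⇒neighbour vz
    ...   | qy , v̂qy , ay | qz , v̂qz , az with all-ι qy (bag-edge v̂qy) | all-ι qz (bag-edge v̂qz)
    ...     | y′ , refl | z′ , refl =
      v̂ , ι y′ , ι z′ , U⇒≢ v̂qy , ι-y′≢ι-z′ , U⇒≢ v̂qz , ε , bag-edge v̂qy , bag-edge v̂qz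
      where
      ι-y′≢ι-z′ : ι y′ ≢ ι z′
      ι-y′≢ι-z′ e = y≢z (trans (accessible-ι ay)
                        (trans (accessible-ι (subst (λ p → Accessible p y′) e (ι-accessible y′)))
                               (sym (accessible-ι az))))

    simplicial⇒bigCompleteBag : HasBigCompleteBagWithUnmarked D
    simplicial⇒bigCompleteBag = v̂ , bag-complete , bag-three , v̂ , ε , ι-unmarked v

proposition4p7 : ∀ {n : ℕ} (G : Graph n) → Connected G → BlockGraph G →
    (D : MarkedGraph) → SplitDecomposition G D → Canonical D →
    (HasSimplicialOfDegree≥2 G ⇔ HasBigCompleteBagWithUnmarked D)
proposition4p7 G connected blockGraph D decomposition (bag-types , _) =
  mk⇔ (λ (v , v-simplicial , y , z , y≢z , vy , vz) →
         SimplicialVertex.simplicial⇒bigCompleteBag bag-types v-simplicial y≢z vy vz)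
      bigCompleteBag⇒simplicial
  where
  open Decomposition blockGraph (Realisations.realisation G connected decomposition)
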